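{- Let $f_{0,0}=1$ and, for $n\ge1$ and $k\ge0$, let $f_{n,k}$ be the number of Dyck paths of semi-length $n$ with exactly $k$ marked down-steps, none of which is at ground level (and $f_{0,k}=0$ for $k\ge1$). Then the formal power series $F=F(t,x)=\sum_{n,k\ge0}f_{n,k}t^kx^n$ satisfies $$F=1+xF^2\cdot\frac{1}{1-t(F-1)}.$$
   Context: A Dyck path of semi-length $n$ is a lattice path from $(0,0)$ to $(2n,0)$ with steps $(1,1)$ (up) and $(1,-1)$ (down) never going below the $x$-axis. A down-step is at ground level if it ends on the $x$-axis. A Dyck path with $k$ marked down-steps means a Dyck path together with a $k$-element set of its down-steps. -}

module Defs where

open import Data.Nat using (ℕ; zero; suc; _∸_; _*_)
open import Data.Bool using (Bool; true; false; _∧_)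
open import Data.List using (List; []; _∷_; length; filter; concatMap; map)
open import Data.Integer using (ℤ; +_; _+_; _-_) renaming (_*_ to _*ℤ_)
open import Relation.Binary.PropositionalEquality using (_≡_)
open import Relation.Nullary.Decidable using (Dec; yes; no)
open import Data.Bool using () renaming (_≟_ to _≟B_)
import Data.Nat as N

-- Dyck paths with marked down-steps.
-- A Dyck path together with a set of marked down-steps is encoded as a
-- word over three letters: U (up), D (unmarked down), M (marked down).

data Step : Set where
  U D M : Step

words : ℕ → List (List Step)
words zero    = [] ∷ []
words (suc l) = concatMap (λ w → (U ∷ w) ∷ (D ∷ w) ∷ (M ∷ w) ∷ []) (words l)

-- `good h w` : starting at height h, the underlying path of w never goes
-- below the x-axis, ends on the x-axis, and no marked down-step ends on
-- the x-axis (i.e. no marked down-step is at ground level).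
good : ℕ → List Step → Bool
good zero          []      = true
good (suc h)       []      = false
good h             (U ∷ w) = good (suc h) w
good zero          (D ∷ w) = false
good (suc h)       (D ∷ w) = good h w
good zero          (M ∷ w) = false
good (suc zero)    (M ∷ w) = false
good (suc (suc h)) (M ∷ w) = good (suc h) w

marks : List Step → ℕ
marks []      = 0
marks (U ∷ w) = marks w
marks (D ∷ w) = marks w
marks (M ∷ w) = suc (marks w)

f : ℕ → ℕ → ℕ
f n k = length (filter (λ w → (good 0 w ∧ (marks w N.≡ᵇ k)) ≟B true) (words (2 * n)))

-- Formal power series in x and t with integer coefficients:
-- A n k is the coefficient of x^n t^k.

PS : Set
PS = ℕ → ℕ → ℤ

sumTo : ℕ → (ℕ → ℤ) → ℤ
sumTo zero    g = g 0
sumTo (suc n) g = sumTo n g + g (suc n)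

_⊕_ : PS → PS → PS
(A ⊕ B) n k = A n k + B n k

_⊖_ : PS → PS → PS
(A ⊖ B) n k = A n k - B n k

_⊗_ : PS → PS → PS
(A ⊗ B) n k = sumTo n (λ i → sumTo k (λ j → A i j *ℤ B (n ∸ i) (k ∸ j)))

𝟙 : PS
𝟙 zero zero = + 1
𝟙 _    _    = + 0

𝕩 : PS
𝕩 (suc zero) zero = + 1
𝕩 _          _    = + 0

𝕥 : PS
𝕥 zero (suc zero) = + 1
𝕥 _    _          = + 0

_^_ : PS → ℕ → PS
A ^ zero  = 𝟙
A ^ suc j = A ⊗ (A ^ j)

-- 1 / (1 - t·A) = Σ_{j ≥ 0} t^j A^j ; the coefficient of x^n t^k only
-- receives contributions from j ≤ k, so it is the finite sum below.
inv1-t : PS → PS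
inv1-t A n k = sumTo k (λ j → (A ^ j) n (k ∸ j))

F : PS
F n k = + f n k

_≐_ : PS → PS → Set
A ≐ B = ∀ n k → A n k ≡ B n k

-- Let W h be the series of paths from height h down to the ground whose marked
-- down-steps all stay above the ground, x counting half of the length in excess
-- of h. The first step gives W 0 = 1 + x W 1, W 1 = W 0 + x W 2 and
-- W (h+2) = (1+t) W (h+1) + x W (h+3), a system determining every W h from
-- W 0 = F. If G = 1 + x(1+t)G² (Dyck paths in which any down-step may be
-- marked), then W (h+1) = ((1+t)G)^h G F solves it too, hence F = 1 + x G F.
-- With this, G and F + t(F - 1)G solve the same equation Y = 1 + t x G² + x G Y,
-- so G = F/(1 - t(F - 1)), and substituting into F = 1 + x G F gives the claim.
-- Equations Y = a + x B Y and Y = a + t B Y have unique solutions because they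
-- are contractions for the x-adic and the t-adic filtration respectively.

module Submission where

open import Defs

open import Algebra.Bundles using (CommutativeSemiring)
import Algebra.Construct.Pointwise as Pointwise
open import Algebra.Core using (Op₂)
import Algebra.Solver.Ring.NaturalCoefficients.Default
open import Algebra.Structures using (IsCommutativeSemiring)
open import Algebra.Structures.Biased using (isCommutativeSemiringˡ; isCommutativeMonoidˡ)
import Data.Integer.Solver
open import Data.Nat using (ℕ; zero; suc; _∸_; _≡ᵇ_; _≤_; _<_; _≤′_; ≤′-refl; ≤′-step; z≤n; s≤s)
  renaming (_+_ to _+ℕ_; _*_ to _*ℕ_)
open import Data.Nat.Properties
  using (m∸[m∸n]≡n; m+[n∸m]≡n; ≤-refl; ≤-trans; m∸n≤m; n≤1+n; m≤n⇒m≤1+n; ≤⇒≤′; ≤′⇒≤)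
open import Relation.Binary.Core using (Rel)
import Relation.Binary.PropositionalEquality as ≡
import Relation.Binary.Reasoning.Setoid

module _ {a ℓ} {A : Set a} {_≈_ : Rel A ℓ} {_+_ _*_ _*′_ : Op₂ A} {0# 1# 1′ : A}
         (isCS : IsCommutativeSemiring _≈_ _+_ _*_ 0# 1#) where

  open IsCommutativeSemiring isCS
  open import Relation.Binary.Reasoning.Setoid setoid

  isCommutativeSemiring-resp : (∀ x y → (x *′ y) ≈ (x * y)) → 1′ ≈ 1# →
                               IsCommutativeSemiring _≈_ _+_ _*′_ 0# 1′
  isCommutativeSemiring-resp *′≈* 1′≈1 = isCommutativeSemiringˡ record
    { +-isCommutativeMonoid = +-isCommutativeMonoid
    ; *-isCommutativeMonoid = isCommutativeMonoidˡ record
      { isSemigroup = record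
        { isMagma = record { isEquivalence = isEquivalence ; ∙-cong = *′-cong }
        ; assoc   = λ x y z → begin
            (x *′ y) *′ z  ≈⟨ *′≈* _ z ⟩
            (x *′ y) * z   ≈⟨ *-cong (*′≈* x y) refl ⟩
            (x * y) * z    ≈⟨ *-assoc x y z ⟩
            x * (y * z)    ≈⟨ *-cong refl (*′≈* y z) ⟨
            x * (y *′ z)   ≈⟨ *′≈* x _ ⟨
            x *′ (y *′ z)  ∎
        }
      ; identityˡ = λ x → trans (*′≈* 1′ x) (trans (*-cong 1′≈1 refl) (*-identityˡ x))
      ; comm      = λ x y → trans (*′≈* x y) (trans (*-comm x y) (sym (*′≈* y x)))
      }
    ; distribʳ = λ z x y → trans (*′≈* _ z) (trans (distribʳ z x y) (sym (+-cong (*′≈* x z) (*′≈* y z))))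
    ; zeroˡ    = λ x → trans (*′≈* 0# x) (zeroˡ x)
    }
    where
    *′-cong : ∀ {x y u v} → x ≈ y → u ≈ v → (x *′ u) ≈ (y *′ v)
    *′-cong x≈y u≈v = trans (*′≈* _ _) (trans (*-cong x≈y u≈v) (sym (*′≈* _ _)))

module PowerSeries {c ℓ} (S : CommutativeSemiring c ℓ) where

  open CommutativeSemiring S
  open import Relation.Binary.Reasoning.Setoid setoid
  open import Algebra.Solver.Ring.NaturalCoefficients.Default S

  Series : Set c
  Series = ℕ → Carrier

  infix 4 _≋_

  _≋_ : Series → Series → Set ℓ
  A ≋ B = ∀ n → A n ≈ B n

  ∑ : ℕ → (ℕ → Carrier) → Carrier
  ∑ zero    g = g 0
  ∑ (suc n) g = ∑ n g + g (suc n)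

  ∑-cong : ∀ n {g h : ℕ → Carrier} → (∀ {i} → i ≤ n → g i ≈ h i) → ∑ n g ≈ ∑ n h
  ∑-cong zero    g≈h = g≈h z≤n
  ∑-cong (suc n) g≈h = +-cong (∑-cong n (λ i≤n → g≈h (m≤n⇒m≤1+n i≤n))) (g≈h ≤-refl)

  ∑-suc : ∀ n g → ∑ (suc n) g ≈ g 0 + ∑ n (λ i → g (suc i))
  ∑-suc zero    g = refl
  ∑-suc (suc n) g = trans (+-cong (∑-suc n g) refl) (+-assoc _ _ _)

  ∑-distrib-+ : ∀ n g h → ∑ n (λ i → g i + h i) ≈ ∑ n g + ∑ n h
  ∑-distrib-+ zero    g h = refl
  ∑-distrib-+ (suc n) g h = trans (+-cong (∑-distrib-+ n g h) refl)
    (solve 4 (λ a b c d → (a :+ b) :+ (c :+ d) := (a :+ c) :+ (b :+ d)) refl _ _ _ _)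

  *-distribˡ-∑ : ∀ n a g → a * ∑ n g ≈ ∑ n (λ i → a * g i)
  *-distribˡ-∑ zero    a g = refl
  *-distribˡ-∑ (suc n) a g = trans (distribˡ a _ _) (+-cong (*-distribˡ-∑ n a g) refl)

  ∑-zero : ∀ n {g} → (∀ {i} → i ≤ n → g i ≈ 0#) → ∑ n g ≈ 0#
  ∑-zero n g≈0 = trans (∑-cong n g≈0) (zero-sum n)
    where
    zero-sum : ∀ n → ∑ n (λ _ → 0#) ≈ 0#
    zero-sum zero    = refl
    zero-sum (suc n) = trans (+-identityʳ _) (zero-sum n)

  ∑-reverse : ∀ n g → ∑ n g ≈ ∑ n (λ i → g (n ∸ i))
  ∑-reverse zero    g = refl
  ∑-reverse (suc n) g = begin
    ∑ n g + g (suc n)                     ≈⟨ +-comm _ _ ⟩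
    g (suc n) + ∑ n g                     ≈⟨ +-cong refl (∑-reverse n g) ⟩
    g (suc n) + ∑ n (λ i → g (n ∸ i))     ≈⟨ ∑-suc n (λ i → g (suc n ∸ i)) ⟨
    ∑ (suc n) (λ i → g (suc n ∸ i))       ∎

  infixl 7 _⋆_
  infixl 6 _+ₛ_

  _+ₛ_ : Series → Series → Series
  (A +ₛ B) n = A n + B n

  _⋆_ : Series → Series → Series
  (A ⋆ B) n = ∑ n (λ i → A i * B (n ∸ i))

  0ₛ : Series
  0ₛ _ = 0#

  1ₛ : Series
  1ₛ zero    = 1#
  1ₛ (suc _) = 0#

  Xₛ : Series
  Xₛ 1 = 1#
  Xₛ _ = 0#

  Cₛ : Carrier → Series
  Cₛ a zero    = a
  Cₛ a (suc _) = 0#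

  ⋆-cong : ∀ {A A′ B B′} → A ≋ A′ → B ≋ B′ → A ⋆ B ≋ A′ ⋆ B′
  ⋆-cong A≋A′ B≋B′ n = ∑-cong n (λ {i} _ → *-cong (A≋A′ i) (B≋B′ (n ∸ i)))

  ⋆-congʳ : ∀ {A A′} B → A ≋ A′ → A ⋆ B ≋ A′ ⋆ B
  ⋆-congʳ B A≋A′ n = ∑-cong n (λ {i} _ → *-cong (A≋A′ i) refl)

  ⋆-suc : ∀ A B n → (A ⋆ B) (suc n) ≈ A 0 * B (suc n) + ((λ i → A (suc i)) ⋆ B) n
  ⋆-suc A B n = ∑-suc n (λ i → A i * B (suc n ∸ i))

  ⋆-comm : ∀ A B → A ⋆ B ≋ B ⋆ A
  ⋆-comm A B n = trans (∑-reverse n _) (∑-cong n (λ i≤n →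
    trans (*-cong refl (reflexive (≡.cong B (m∸[m∸n]≡n i≤n)))) (*-comm _ _)))

  ⋆-distribʳ : ∀ C A B → (A +ₛ B) ⋆ C ≋ A ⋆ C +ₛ B ⋆ C
  ⋆-distribʳ C A B n = trans (∑-cong n (λ _ → distribʳ _ _ _)) (∑-distrib-+ n _ _)

  ⋆-scaleˡ : ∀ a A B n → ((λ i → a * A i) ⋆ B) n ≈ a * (A ⋆ B) n
  ⋆-scaleˡ a A B n = trans (∑-cong n (λ _ → *-assoc _ _ _)) (sym (*-distribˡ-∑ n a _))

  ⋆-zeroˡ : ∀ A → 0ₛ ⋆ A ≋ 0ₛ
  ⋆-zeroˡ A n = ∑-zero n (λ _ → zeroˡ _)

  ⋆-identityˡ : ∀ A → 1ₛ ⋆ A ≋ A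
  ⋆-identityˡ A zero    = *-identityˡ _
  ⋆-identityˡ A (suc n) = begin
    (1ₛ ⋆ A) (suc n)               ≈⟨ ⋆-suc 1ₛ A n ⟩
    1# * A (suc n) + (0ₛ ⋆ A) n    ≈⟨ +-cong (*-identityˡ _) (⋆-zeroˡ A n) ⟩
    A (suc n) + 0#                 ≈⟨ +-identityʳ _ ⟩
    A (suc n)                      ∎

  ⋆-assoc : ∀ A B C → (A ⋆ B) ⋆ C ≋ A ⋆ (B ⋆ C)
  ⋆-assoc A B C zero    = *-assoc _ _ _
  ⋆-assoc A B C (suc n) = begin
    ((A ⋆ B) ⋆ C) (suc n)
      ≈⟨ ⋆-suc (A ⋆ B) C n ⟩
    (A 0 * B 0) * C (suc n) + ((λ m → (A ⋆ B) (suc m)) ⋆ C) n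
      ≈⟨ +-cong refl (⋆-congʳ C (λ m → ⋆-suc A B m) n) ⟩
    (A 0 * B 0) * C (suc n) + (((λ m → A 0 * B (suc m)) +ₛ (A⁺ ⋆ B)) ⋆ C) n
      ≈⟨ +-cong refl (⋆-distribʳ C _ _ n) ⟩
    (A 0 * B 0) * C (suc n) + (((λ m → A 0 * B (suc m)) ⋆ C) n + ((A⁺ ⋆ B) ⋆ C) n)
      ≈⟨ +-cong refl (+-cong (⋆-scaleˡ (A 0) _ C n) (⋆-assoc A⁺ B C n)) ⟩
    (A 0 * B 0) * C (suc n) + (A 0 * (B⁺ ⋆ C) n + (A⁺ ⋆ (B ⋆ C)) n)
      ≈⟨ solve 5 (λ a b c d e → (a :* b) :* c :+ (a :* d :+ e) := a :* (b :* c :+ d) :+ e)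
           refl (A 0) (B 0) (C (suc n)) _ _ ⟩
    A 0 * (B 0 * C (suc n) + (B⁺ ⋆ C) n) + (A⁺ ⋆ (B ⋆ C)) n
      ≈⟨ +-cong (*-cong refl (⋆-suc B C n)) refl ⟨
    A 0 * (B ⋆ C) (suc n) + (A⁺ ⋆ (B ⋆ C)) n
      ≈⟨ ⋆-suc A (B ⋆ C) n ⟨
    (A ⋆ (B ⋆ C)) (suc n) ∎
    where
    A⁺ B⁺ : Series
    A⁺ i = A (suc i)
    B⁺ i = B (suc i)

  ⋆-isCommutativeSemiring : IsCommutativeSemiring _≋_ _+ₛ_ _⋆_ 0ₛ 1ₛ
  ⋆-isCommutativeSemiring = isCommutativeSemiringˡ record
    { +-isCommutativeMonoid = Pointwise.isCommutativeMonoid ℕ +-isCommutativeMonoid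
    ; *-isCommutativeMonoid = isCommutativeMonoidˡ record
      { isSemigroup = record
        { isMagma = record
          { isEquivalence = Pointwise.isEquivalence ℕ isEquivalence
          ; ∙-cong        = ⋆-cong
          }
        ; assoc = ⋆-assoc
        }
      ; identityˡ = ⋆-identityˡ
      ; comm      = ⋆-comm
      }
    ; distribʳ = ⋆-distribʳ
    ; zeroˡ    = ⋆-zeroˡ
    }

  ⋆-commutativeSemiring : CommutativeSemiring c ℓ
  ⋆-commutativeSemiring = record { isCommutativeSemiring = ⋆-isCommutativeSemiring }

  Xₛ⋆-zero : ∀ B → (Xₛ ⋆ B) 0 ≈ 0#
  Xₛ⋆-zero B = zeroˡ _

  Xₛ⋆-suc : ∀ B n → (Xₛ ⋆ B) (suc n) ≈ B n
  Xₛ⋆-suc B n = begin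
    (Xₛ ⋆ B) (suc n)                             ≈⟨ ⋆-suc Xₛ B n ⟩
    0# * B (suc n) + ((λ i → Xₛ (suc i)) ⋆ B) n  ≈⟨ +-cong (zeroˡ _) (⋆-congʳ B Xₛ⁺≋1ₛ n) ⟩
    0# + (1ₛ ⋆ B) n                              ≈⟨ +-identityˡ _ ⟩
    (1ₛ ⋆ B) n                                   ≈⟨ ⋆-identityˡ B n ⟩
    B n                                          ∎
    where
    Xₛ⁺≋1ₛ : (λ i → Xₛ (suc i)) ≋ 1ₛ
    Xₛ⁺≋1ₛ zero    = refl
    Xₛ⁺≋1ₛ (suc _) = refl

  Cₛ⋆ : ∀ a B n → (Cₛ a ⋆ B) n ≈ a * B n
  Cₛ⋆ a B zero    = refl
  Cₛ⋆ a B (suc n) = trans (⋆-suc (Cₛ a) B n) (trans (+-cong refl (⋆-zeroˡ B n)) (+-identityʳ _))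

open import Data.Bool using (Bool; true; false; _∧_; if_then_else_) renaming (_≟_ to _≟B_)
open import Data.Bool.Properties using (∧-zeroʳ)
open import Data.Integer using (ℤ; +_; _+_; _-_; _*_)
import Data.Integer.Properties as ℤ
open import Data.List using (List; []; _∷_; length; filter; concatMap; _++_)
open import Data.List.Properties using (filter-++; length-++)
import Data.Nat.Properties as ℕ
open import Data.Nat.Solver using (module +-*-Solver)
open import Relation.Binary.PropositionalEquality using (_≡_; refl; sym; trans; cong; cong₂; module ≡-Reasoning)

module ℤ⟦t⟧ = PowerSeries ℤ.+-*-commutativeSemiring
module ℤ⟦t⟧⟦x⟧ = PowerSeries ℤ⟦t⟧.⋆-commutativeSemiring

open ℤ⟦t⟧⟦x⟧ using (_⋆_; 1ₛ; Xₛ; Cₛ)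

sumTo-cong : ∀ n {g h : ℕ → ℤ} → (∀ {i} → i ≤ n → g i ≡ h i) → sumTo n g ≡ sumTo n h
sumTo-cong zero    g≡h = g≡h z≤n
sumTo-cong (suc n) g≡h = cong₂ _+_ (sumTo-cong n (λ i≤n → g≡h (m≤n⇒m≤1+n i≤n))) (g≡h ≤-refl)

sumTo≡∑ : ∀ n g → sumTo n g ≡ ℤ⟦t⟧.∑ n g
sumTo≡∑ zero    g = refl
sumTo≡∑ (suc n) g = cong (_+ g (suc n)) (sumTo≡∑ n g)

sumTo-suc : ∀ n g → sumTo (suc n) g ≡ g 0 + sumTo n (λ i → g (suc i))
sumTo-suc n g = trans (sumTo≡∑ (suc n) g) (trans (ℤ⟦t⟧.∑-suc n g) (cong (_+_ (g 0)) (sym (sumTo≡∑ n _))))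

sumTo-tail-zero : ∀ {k K} g → k ≤ K → (∀ {j} → k < j → g j ≡ + 0) → sumTo K g ≡ sumTo k g
sumTo-tail-zero {k} g k≤K g≡0 = tail (≤⇒≤′ k≤K)
  where
  tail : ∀ {K} → k ≤′ K → sumTo K g ≡ sumTo k g
  tail ≤′-refl          = refl
  tail (≤′-step k≤′K) =
    trans (cong₂ _+_ (tail k≤′K) (g≡0 (s≤s (≤′⇒≤ k≤′K)))) (ℤ.+-identityʳ (sumTo k g))

i+j-i≡j : ∀ i j → (i + j) - i ≡ j
i+j-i≡j = solve 2 (λ i j → (i :+ j) :- i := j) refl
  where open Data.Integer.Solver.+-*-Solver

∑-coefficient : ∀ n (g : ℕ → ℕ → ℤ) k → ℤ⟦t⟧⟦x⟧.∑ n g k ≡ sumTo n (λ i → g i k)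
∑-coefficient zero    g k = refl
∑-coefficient (suc n) g k = cong (_+ g (suc n) k) (∑-coefficient n g k)

⊗≐⋆ : ∀ A B → (A ⊗ B) ≐ (A ⋆ B)
⊗≐⋆ A B n k = sym (trans (∑-coefficient n _ k) (sumTo-cong n (λ _ → sym (sumTo≡∑ k _))))

𝟙≐1ₛ : 𝟙 ≐ 1ₛ
𝟙≐1ₛ zero    zero    = refl
𝟙≐1ₛ zero    (suc k) = refl
𝟙≐1ₛ (suc n) k       = refl

𝕩≐Xₛ : 𝕩 ≐ Xₛ
𝕩≐Xₛ zero          k       = refl
𝕩≐Xₛ 1             zero    = refl
𝕩≐Xₛ 1             (suc k) = refl
𝕩≐Xₛ (suc (suc n)) k       = refl

𝕥≐Cₛ : 𝕥 ≐ Cₛ ℤ⟦t⟧.Xₛ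
𝕥≐Cₛ zero    zero          = refl
𝕥≐Cₛ zero    1             = refl
𝕥≐Cₛ zero    (suc (suc k)) = refl
𝕥≐Cₛ (suc n) k             = refl

PS-commutativeSemiring : CommutativeSemiring _ _
PS-commutativeSemiring = record
  { isCommutativeSemiring = isCommutativeSemiring-resp ℤ⟦t⟧⟦x⟧.⋆-isCommutativeSemiring ⊗≐⋆ 𝟙≐1ₛ }

module PS = CommutativeSemiring PS-commutativeSemiring

module PS-Reasoning = Relation.Binary.Reasoning.Setoid PS.setoid
module PS-Solver = Algebra.Solver.Ring.NaturalCoefficients.Default PS-commutativeSemiring

⊗-congˡ : ∀ A {B B′} → B ≐ B′ → (A ⊗ B) ≐ (A ⊗ B′)
⊗-congˡ A = PS.*-congˡ {A}

⊗-congʳ : ∀ {A A′} B → A ≐ A′ → (A ⊗ B) ≐ (A′ ⊗ B)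
⊗-congʳ B = PS.*-congʳ {B}

⊕-congˡ : ∀ A {B B′} → B ≐ B′ → (A ⊕ B) ≐ (A ⊕ B′)
⊕-congˡ A = PS.+-congˡ {A}

𝕩⊗-zero : ∀ B k → (𝕩 ⊗ B) 0 k ≡ + 0
𝕩⊗-zero B k =
  trans (⊗≐⋆ 𝕩 B 0 k) (trans (ℤ⟦t⟧⟦x⟧.⋆-congʳ B 𝕩≐Xₛ 0 k) (ℤ⟦t⟧⟦x⟧.Xₛ⋆-zero B k))

𝕩⊗-suc : ∀ B n k → (𝕩 ⊗ B) (suc n) k ≡ B n k
𝕩⊗-suc B n k =
  trans (⊗≐⋆ 𝕩 B (suc n) k) (trans (ℤ⟦t⟧⟦x⟧.⋆-congʳ B 𝕩≐Xₛ (suc n) k) (ℤ⟦t⟧⟦x⟧.Xₛ⋆-suc B n k))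

𝕥⊗≐Xₛ⋆ : ∀ B n → (𝕥 ⊗ B) n ℤ⟦t⟧.≋ (ℤ⟦t⟧.Xₛ ℤ⟦t⟧.⋆ B n)
𝕥⊗≐Xₛ⋆ B n k =
  trans (⊗≐⋆ 𝕥 B n k) (trans (ℤ⟦t⟧⟦x⟧.⋆-congʳ B 𝕥≐Cₛ n k) (ℤ⟦t⟧⟦x⟧.Cₛ⋆ ℤ⟦t⟧.Xₛ B n k))

𝕥⊗-zero : ∀ B n → (𝕥 ⊗ B) n 0 ≡ + 0
𝕥⊗-zero B n = trans (𝕥⊗≐Xₛ⋆ B n 0) (ℤ⟦t⟧.Xₛ⋆-zero (B n))

𝕥⊗-suc : ∀ B n k → (𝕥 ⊗ B) n (suc k) ≡ B n k
𝕥⊗-suc B n k = trans (𝕥⊗≐Xₛ⋆ B n (suc k)) (ℤ⟦t⟧.Xₛ⋆-suc (B n) k)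

record Grading : Set where
  field
    deg  : ℕ → ℕ → ℕ
    mono : ∀ {i j n k} → i ≤ n → j ≤ k → deg i j ≤ deg n k

open Grading

x-grading : Grading
x-grading = record { deg = λ n _ → n ; mono = λ i≤n _ → i≤n }

t-grading : Grading
t-grading = record { deg = λ _ k → k ; mono = λ _ j≤k → j≤k }

infix 4 _≐[_<_]_

record _≐[_<_]_ (A : PS) (g : Grading) (r : ℕ) (B : PS) : Set where
  constructor agree
  field coeff : ∀ n k → deg g n k < r → A n k ≡ B n k

open _≐[_<_]_

module _ {g : Grading} where

  ≐⇒≐[<] : ∀ {A B r} → A ≐ B → A ≐[ g < r ] B
  ≐⇒≐[<] A≐B = agree (λ n k _ → A≐B n k)

  ≐[<]-refl : ∀ A {r} → A ≐[ g < r ] A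
  ≐[<]-refl A = agree (λ _ _ _ → refl)

  ≐[<]-sym : ∀ {A B r} → A ≐[ g < r ] B → B ≐[ g < r ] A
  ≐[<]-sym A≐B = agree (λ n k d<r → sym (coeff A≐B n k d<r))

  ≐[<]-trans : ∀ {A B C r} → A ≐[ g < r ] B → B ≐[ g < r ] C → A ≐[ g < r ] C
  ≐[<]-trans A≐B B≐C = agree (λ n k d<r → trans (coeff A≐B n k d<r) (coeff B≐C n k d<r))

  ≐[<]-weaken : ∀ {A B r s} → r ≤ s → A ≐[ g < s ] B → A ≐[ g < r ] B
  ≐[<]-weaken r≤s A≐B = agree (λ n k d<r → coeff A≐B n k (≤-trans d<r r≤s))

  ≐[<]⇒≐ : ∀ {A B} → (∀ r → A ≐[ g < suc r ] B) → A ≐ B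
  ≐[<]⇒≐ A≐B n k = coeff (A≐B (deg g n k)) n k ≤-refl

  ⊕-agree : ∀ {A A′ B B′ r} → A ≐[ g < r ] A′ → B ≐[ g < r ] B′ → (A ⊕ B) ≐[ g < r ] (A′ ⊕ B′)
  ⊕-agree A≐A′ B≐B′ = agree (λ n k d<r → cong₂ _+_ (coeff A≐A′ n k d<r) (coeff B≐B′ n k d<r))

  ⊗-agree : ∀ {A A′ B B′ r} → A ≐[ g < r ] A′ → B ≐[ g < r ] B′ → (A ⊗ B) ≐[ g < r ] (A′ ⊗ B′)
  ⊗-agree A≐A′ B≐B′ = agree λ n k d<r → sumTo-cong n λ {i} i≤n → sumTo-cong k λ {j} j≤k →
    cong₂ _*_ (coeff A≐A′ i j (≤-trans (s≤s (mono g i≤n j≤k)) d<r))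
              (coeff B≐B′ (n ∸ i) (k ∸ j) (≤-trans (s≤s (mono g (m∸n≤m n i) (m∸n≤m k j))) d<r))

Contractive : Grading → (PS → PS) → Set
Contractive g Φ = ∀ {r A B} → A ≐[ g < r ] B → Φ A ≐[ g < suc r ] Φ B

𝕩⊗-contractive : Contractive x-grading (𝕩 ⊗_)
𝕩⊗-contractive {A = A} {B} A≐B = agree λ
  { zero    k _         → trans (𝕩⊗-zero A k) (sym (𝕩⊗-zero B k))
  ; (suc n) k (s≤s n<r) → trans (𝕩⊗-suc A n k) (trans (coeff A≐B n k n<r) (sym (𝕩⊗-suc B n k)))
  }

𝕥⊗-contractive : Contractive t-grading (𝕥 ⊗_)
𝕥⊗-contractive {A = A} {B} A≐B = agree λ
  { n zero    _         → trans (𝕥⊗-zero A n) (sym (𝕥⊗-zero B n))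
  ; n (suc k) (s≤s k<r) → trans (𝕥⊗-suc A n k) (trans (coeff A≐B n k k<r) (sym (𝕥⊗-suc B n k)))
  }

affine-contractive : ∀ {g} v → Contractive g (v ⊗_) → ∀ a B → Contractive g (λ Y → a ⊕ (v ⊗ (B ⊗ Y)))
affine-contractive v v-contractive a B Y≐Y′ = ⊕-agree (≐[<]-refl a) (v-contractive (⊗-agree (≐[<]-refl B) Y≐Y′))

module _ {g : Grading} {Φ : PS → PS} (Φ-contractive : Contractive g Φ) where

  fixedPoint-unique : ∀ {X Y} → X ≐ Φ X → Y ≐ Φ Y → X ≐ Y
  fixedPoint-unique {X} {Y} X≐ΦX Y≐ΦY = ≐[<]⇒≐ (λ r → agree-below (suc r))
    where
    agree-below : ∀ r → X ≐[ g < r ] Y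
    agree-below zero    = agree (λ _ _ ())
    agree-below (suc r) = ≐[<]-trans (≐⇒≐[<] X≐ΦX)
      (≐[<]-trans (Φ-contractive (agree-below r)) (≐⇒≐[<] (PS.sym Y≐ΦY)))

  iterate : ℕ → PS
  iterate zero    _ _ = + 0
  iterate (suc m)     = Φ (iterate m)

  iterate-agree : ∀ {r m} → r ≤ m → iterate r ≐[ g < r ] iterate m
  iterate-agree {zero}          _         = agree (λ _ _ ())
  iterate-agree {suc r} {suc m} (s≤s r≤m) = Φ-contractive (iterate-agree r≤m)

  -- Coefficients of degree d no longer change after d + 1 iterations.
  fixedPoint : PS
  fixedPoint n k = iterate (suc (deg g n k)) n k

  fixedPoint-approx : ∀ r → fixedPoint ≐[ g < r ] iterate r
  fixedPoint-approx r = agree λ n k d<r → coeff (iterate-agree d<r) n k ≤-refl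

  fixedPoint-eq : fixedPoint ≐ Φ fixedPoint
  fixedPoint-eq n k = sym (coeff (Φ-contractive (fixedPoint-approx (deg g n k))) n k ≤-refl)

^-distrib-⊗ : ∀ A B j → ((A ⊗ B) ^ j) ≐ ((A ^ j) ⊗ (B ^ j))
^-distrib-⊗ A B zero    = PS.sym (PS.*-identityˡ 𝟙)
^-distrib-⊗ A B (suc j) = begin
  (A ⊗ B) ⊗ ((A ⊗ B) ^ j)        ≈⟨ ⊗-congˡ (A ⊗ B) (^-distrib-⊗ A B j) ⟩
  (A ⊗ B) ⊗ ((A ^ j) ⊗ (B ^ j))  ≈⟨ solve 4 (λ a b aʲ bʲ → (a :* b) :* (aʲ :* bʲ) := (a :* aʲ) :* (b :* bʲ))
                                      PS.refl A B (A ^ j) (B ^ j) ⟩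
  (A ⊗ (A ^ j)) ⊗ (B ⊗ (B ^ j))  ∎
  where
  open PS-Reasoning
  open PS-Solver

𝕥^⊗-shift : ∀ j Y n k → ((𝕥 ^ j) ⊗ Y) n (j +ℕ k) ≡ Y n k
𝕥^⊗-shift zero    Y n k = PS.*-identityˡ Y n k
𝕥^⊗-shift (suc j) Y n k =
  trans (PS.*-assoc 𝕥 (𝕥 ^ j) Y n (suc (j +ℕ k)))
        (trans (𝕥⊗-suc ((𝕥 ^ j) ⊗ Y) n (j +ℕ k)) (𝕥^⊗-shift j Y n k))

𝕥^⊗-low : ∀ j Y n k → k < j → ((𝕥 ^ j) ⊗ Y) n k ≡ + 0
𝕥^⊗-low (suc j) Y n zero    _         = trans (PS.*-assoc 𝕥 (𝕥 ^ j) Y n 0) (𝕥⊗-zero ((𝕥 ^ j) ⊗ Y) n)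
𝕥^⊗-low (suc j) Y n (suc k) (s≤s k<j) =
  trans (PS.*-assoc 𝕥 (𝕥 ^ j) Y n (suc k)) (trans (𝕥⊗-suc ((𝕥 ^ j) ⊗ Y) n k) (𝕥^⊗-low j Y n k k<j))

⊗-distribˡ-sumTo : ∀ C K (Q : ℕ → PS) →
                   (C ⊗ (λ n k → sumTo K (λ j → Q j n k))) ≐ (λ n k → sumTo K (λ j → (C ⊗ Q j) n k))
⊗-distribˡ-sumTo C zero    Q = PS.refl
⊗-distribˡ-sumTo C (suc K) Q n k =
  trans (PS.distribˡ C (λ n k → sumTo K (λ j → Q j n k)) (Q (suc K)) n k)
        (cong (_+ (C ⊗ Q (suc K)) n k) (⊗-distribˡ-sumTo C K Q n k))

module _ (A : PS) where

  𝕥A^-coeff : ∀ j n k → j ≤ k → ((𝕥 ⊗ A) ^ j) n k ≡ (A ^ j) n (k ∸ j)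
  𝕥A^-coeff j n k j≤k = trans (^-distrib-⊗ 𝕥 A j n k)
    (trans (cong (((𝕥 ^ j) ⊗ (A ^ j)) n) (sym (m+[n∸m]≡n j≤k))) (𝕥^⊗-shift j (A ^ j) n (k ∸ j)))

  𝕥A^-low : ∀ j n k → k < j → ((𝕥 ⊗ A) ^ j) n k ≡ + 0
  𝕥A^-low j n k k<j = trans (^-distrib-⊗ 𝕥 A j n k) (𝕥^⊗-low j (A ^ j) n k k<j)

  geometric : ℕ → PS
  geometric K n k = sumTo K (λ j → ((𝕥 ⊗ A) ^ j) n k)

  geometric-suc : ∀ K → geometric (suc K) ≐ (𝟙 ⊕ (𝕥 ⊗ (A ⊗ geometric K)))
  geometric-suc K n k = begin
    geometric (suc K) n k
      ≡⟨ sumTo-suc K _ ⟩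
    𝟙 n k + sumTo K (λ j → ((𝕥 ⊗ A) ⊗ ((𝕥 ⊗ A) ^ j)) n k)
      ≡⟨ cong (_+_ (𝟙 n k)) (sym (⊗-distribˡ-sumTo (𝕥 ⊗ A) K (λ j → (𝕥 ⊗ A) ^ j) n k)) ⟩
    𝟙 n k + ((𝕥 ⊗ A) ⊗ geometric K) n k
      ≡⟨ cong (_+_ (𝟙 n k)) (PS.*-assoc 𝕥 A (geometric K) n k) ⟩
    𝟙 n k + (𝕥 ⊗ (A ⊗ geometric K)) n k ∎
    where open ≡-Reasoning

  inv1-t≐[<]geometric : ∀ K → inv1-t A ≐[ t-grading < suc K ] geometric K
  inv1-t≐[<]geometric K = agree λ where
    n k (s≤s k≤K) → trans (sumTo-cong k (λ {j} j≤k → sym (𝕥A^-coeff j n k j≤k)))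
                      (sym (sumTo-tail-zero _ k≤K (λ {j} k<j → 𝕥A^-low j n k k<j)))

  inv1-t-rec : inv1-t A ≐ (𝟙 ⊕ (𝕥 ⊗ (A ⊗ inv1-t A)))
  inv1-t-rec = ≐[<]⇒≐ λ K → ≐[<]-weaken (n≤1+n _) (
    ≐[<]-trans (inv1-t≐[<]geometric (suc K)) (
    ≐[<]-trans (≐⇒≐[<] (geometric-suc K)) (
    ⊕-agree (≐[<]-refl 𝟙) (𝕥⊗-contractive (⊗-agree (≐[<]-refl A) (≐[<]-sym (inv1-t≐[<]geometric K)))))))

count : (List Step → Bool) → List (List Step) → ℕ
count p ws = length (filter (λ w → p w ≟B true) ws)

count-∷ : ∀ p w ws → count p (w ∷ ws) ≡ (if p w then 1 else 0) +ℕ count p ws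
count-∷ p w ws with p w
... | true  = refl
... | false = refl

count-++ : ∀ p ws vs → count p (ws ++ vs) ≡ count p ws +ℕ count p vs
count-++ p ws vs = trans (cong length (filter-++ (λ w → p w ≟B true) ws vs)) (length-++ (filter _ ws))

count-none : ∀ {p} ws → (∀ w → p w ≡ false) → count p ws ≡ 0
count-none []       p≡false = refl
count-none (w ∷ ws) p≡false = trans (count-∷ _ w ws)
  (cong₂ _+ℕ_ (cong (λ b → if b then 1 else 0) (p≡false w)) (count-none ws p≡false))

extend : List Step → List (List Step)
extend w = (U ∷ w) ∷ (D ∷ w) ∷ (M ∷ w) ∷ []

count-extend : ∀ p ws → count p (concatMap extend ws)
  ≡ count (λ w → p (U ∷ w)) ws +ℕ count (λ w → p (D ∷ w)) ws +ℕ count (λ w → p (M ∷ w)) ws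
count-extend p []       = refl
count-extend p (w ∷ ws) = begin
  count p (extend w ++ concatMap extend ws)
    ≡⟨ count-++ p (extend w) (concatMap extend ws) ⟩
  count p (extend w) +ℕ count p (concatMap extend ws)
    ≡⟨ cong₂ _+ℕ_ (trans (count-∷ p _ _)
                    (cong ([ U ] +ℕ_) (trans (count-∷ p _ _) (cong ([ D ] +ℕ_) (count-∷ p _ _)))))
                  (count-extend p ws) ⟩
  ([ U ] +ℕ ([ D ] +ℕ ([ M ] +ℕ 0))) +ℕ (# U +ℕ # D +ℕ # M)
    ≡⟨ solve 6 (λ u d m u′ d′ m′ → (u :+ (d :+ (m :+ con 0))) :+ (u′ :+ d′ :+ m′)
                                  := (u :+ u′) :+ (d :+ d′) :+ (m :+ m′))
         refl [ U ] [ D ] [ M ] (# U) (# D) (# M) ⟩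
  ([ U ] +ℕ # U) +ℕ ([ D ] +ℕ # D) +ℕ ([ M ] +ℕ # M)
    ≡⟨ sym (cong₂ _+ℕ_ (cong₂ _+ℕ_ (count-∷ (λ v → p (U ∷ v)) w ws) (count-∷ (λ v → p (D ∷ v)) w ws))
                       (count-∷ (λ v → p (M ∷ v)) w ws)) ⟩
  #⁺ U +ℕ #⁺ D +ℕ #⁺ M ∎
  where
  open ≡-Reasoning
  open +-*-Solver
  [_] : Step → ℕ
  [ s ] = if p (s ∷ w) then 1 else 0
  #_ : Step → ℕ
  # s = count (λ v → p (s ∷ v)) ws
  #⁺_ : Step → ℕ
  #⁺ s = count (λ v → p (s ∷ v)) (w ∷ ws)

valid : ℕ → ℕ → List Step → Bool
valid h k w = good h w ∧ (marks w ≡ᵇ k)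

#walks : ℕ → ℕ → ℕ → ℕ
#walks h l k = count (valid h k) (words l)

shiftₜ : (ℕ → ℕ) → ℕ → ℕ
shiftₜ N zero    = 0
shiftₜ N (suc k) = N k

#walks-from-0 : ∀ l k → #walks 0 (suc l) k ≡ #walks 1 l k
#walks-from-0 l k = trans (count-extend (valid 0 k) (words l))
  (trans (cong₂ (λ d m → #walks 1 l k +ℕ d +ℕ m) (count-none (words l) (λ _ → refl)) (count-none (words l) (λ _ → refl)))
         (trans (ℕ.+-identityʳ _) (ℕ.+-identityʳ _)))

#walks-from-1 : ∀ l k → #walks 1 (suc l) k ≡ #walks 2 l k +ℕ #walks 0 l k
#walks-from-1 l k = trans (count-extend (valid 1 k) (words l))
  (trans (cong (#walks 2 l k +ℕ #walks 0 l k +ℕ_) (count-none (words l) (λ _ → refl))) (ℕ.+-identityʳ _))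

#walks-from-2+ : ∀ h l k → #walks (2 +ℕ h) (suc l) k
                           ≡ #walks (3 +ℕ h) l k +ℕ #walks (1 +ℕ h) l k +ℕ shiftₜ (#walks (1 +ℕ h) l) k
#walks-from-2+ h l zero    = trans (count-extend (valid (2 +ℕ h) 0) (words l))
  (cong (#walks (3 +ℕ h) l 0 +ℕ #walks (1 +ℕ h) l 0 +ℕ_) (count-none (words l) (λ w → ∧-zeroʳ (good (1 +ℕ h) w))))
#walks-from-2+ h l (suc k) = count-extend (valid (2 +ℕ h) (suc k)) (words l)

#walks-short : ∀ {h} l k → l < h → #walks h l k ≡ 0
#walks-short {suc h}       zero    k _         = refl
#walks-short {suc zero}    (suc l) k (s≤s ())
#walks-short {suc (suc h)} (suc l) k (s≤s l<1+h) = trans (#walks-from-2+ h l k)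
  (cong₂ _+ℕ_ (cong₂ _+ℕ_ (#walks-short l k (m≤n⇒m≤1+n (m≤n⇒m≤1+n l<1+h))) (#walks-short l k l<1+h))
               (short-shifted k))
  where
  short-shifted : ∀ k → shiftₜ (#walks (1 +ℕ h) l) k ≡ 0
  short-shifted zero    = refl
  short-shifted (suc k) = #walks-short l k l<1+h

WalksFrom : ℕ → PS
WalksFrom h m k = + #walks h (h +ℕ 2 *ℕ m) k

F≐WalksFrom-0 : F ≐ WalksFrom 0
F≐WalksFrom-0 _ _ = refl

+2*-suc : ∀ h m → h +ℕ 2 *ℕ suc m ≡ 2 +ℕ (h +ℕ 2 *ℕ m)
+2*-suc h m = trans (cong (h +ℕ_) (ℕ.*-suc 2 m)) (trans (ℕ.+-suc h (suc (2 *ℕ m))) (cong suc (ℕ.+-suc h (2 *ℕ m))))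

𝕩⊗WalksFrom-2+ : ∀ h m k → (𝕩 ⊗ WalksFrom (2 +ℕ h)) m k ≡ + #walks (2 +ℕ h) (h +ℕ 2 *ℕ m) k
𝕩⊗WalksFrom-2+ h zero    k = trans (𝕩⊗-zero (WalksFrom (2 +ℕ h)) k)
  (sym (cong +_ (#walks-short (h +ℕ 0) k (s≤s (m≤n⇒m≤1+n (ℕ.≤-reflexive (ℕ.+-identityʳ h)))))))
𝕩⊗WalksFrom-2+ h (suc m) k = trans (𝕩⊗-suc (WalksFrom (2 +ℕ h)) m k)
  (cong (λ l → + #walks (2 +ℕ h) l k) (sym (+2*-suc h m)))

𝕥⊗-shiftₜ : ∀ (N : ℕ → ℕ → ℕ) m k → (𝕥 ⊗ (λ m k → + N m k)) m k ≡ + shiftₜ (N m) k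
𝕥⊗-shiftₜ N m zero    = 𝕥⊗-zero (λ m k → + N m k) m
𝕥⊗-shiftₜ N m (suc k) = 𝕥⊗-suc (λ m k → + N m k) m k

T : PS
T = 𝟙 ⊕ 𝕥

T⊗-coeff : ∀ Y m k → (T ⊗ Y) m k ≡ Y m k + (𝕥 ⊗ Y) m k
T⊗-coeff Y m k = trans (PS.distribʳ Y 𝟙 𝕥 m k) (cong (_+ (𝕥 ⊗ Y) m k) (PS.*-identityˡ Y m k))

WalksFrom-0 : WalksFrom 0 ≐ (𝟙 ⊕ (𝕩 ⊗ WalksFrom 1))
WalksFrom-0 zero k = sym (trans (cong (_+_ (𝟙 0 k)) (𝕩⊗-zero (WalksFrom 1) k)) (trans (ℤ.+-identityʳ _) (empty-walk k)))
  where
  empty-walk : ∀ k → 𝟙 0 k ≡ WalksFrom 0 0 k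
  empty-walk zero    = refl
  empty-walk (suc k) = refl
WalksFrom-0 (suc m) k = begin
  + #walks 0 (2 *ℕ suc m) k       ≡⟨ cong (λ l → + #walks 0 l k) (+2*-suc 0 m) ⟩
  + #walks 0 (2 +ℕ 2 *ℕ m) k      ≡⟨ cong +_ (#walks-from-0 (suc (2 *ℕ m)) k) ⟩
  WalksFrom 1 m k                 ≡⟨ 𝕩⊗-suc (WalksFrom 1) m k ⟨
  (𝕩 ⊗ WalksFrom 1) (suc m) k     ≡⟨ ℤ.+-identityˡ _ ⟨
  (𝟙 ⊕ (𝕩 ⊗ WalksFrom 1)) (suc m) k ∎
  where open ≡-Reasoning

WalksFrom-1 : WalksFrom 1 ≐ (WalksFrom 0 ⊕ (𝕩 ⊗ WalksFrom 2))
WalksFrom-1 m k = begin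
  + #walks 1 (suc (2 *ℕ m)) k                         ≡⟨ cong +_ (#walks-from-1 (2 *ℕ m) k) ⟩
  + (#walks 2 (2 *ℕ m) k +ℕ #walks 0 (2 *ℕ m) k)     ≡⟨ ℤ.pos-+ (#walks 2 (2 *ℕ m) k) _ ⟩
  + #walks 2 (2 *ℕ m) k + WalksFrom 0 m k            ≡⟨ ℤ.+-comm (+ #walks 2 (2 *ℕ m) k) (WalksFrom 0 m k) ⟩
  WalksFrom 0 m k + + #walks 2 (2 *ℕ m) k            ≡⟨ cong (_+_ (WalksFrom 0 m k)) (𝕩⊗WalksFrom-2+ 0 m k) ⟨
  WalksFrom 0 m k + (𝕩 ⊗ WalksFrom 2) m k            ∎
  where open ≡-Reasoning

WalksFrom-2+ : ∀ h → WalksFrom (2 +ℕ h) ≐ ((T ⊗ WalksFrom (1 +ℕ h)) ⊕ (𝕩 ⊗ WalksFrom (3 +ℕ h)))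
WalksFrom-2+ h m k = begin
  + #walks (2 +ℕ h) (suc l) k
    ≡⟨ cong +_ (#walks-from-2+ h l k) ⟩
  + (#walks (3 +ℕ h) l k +ℕ #walks (1 +ℕ h) l k +ℕ shiftₜ (#walks (1 +ℕ h) l) k)
    ≡⟨ trans (ℤ.pos-+ (#walks (3 +ℕ h) l k +ℕ #walks (1 +ℕ h) l k) _)
             (cong (_+ + shiftₜ (#walks (1 +ℕ h) l) k) (ℤ.pos-+ (#walks (3 +ℕ h) l k) _)) ⟩
  up + Y m k + + shiftₜ (#walks (1 +ℕ h) l) k
    ≡⟨ cong (_+_ (up + Y m k)) (𝕥⊗-shiftₜ (λ m k → #walks (1 +ℕ h) (1 +ℕ h +ℕ 2 *ℕ m) k) m k) ⟨
  up + Y m k + (𝕥 ⊗ Y) m k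
    ≡⟨ trans (ℤ.+-assoc up (Y m k) ((𝕥 ⊗ Y) m k)) (ℤ.+-comm up (Y m k + (𝕥 ⊗ Y) m k)) ⟩
  (Y m k + (𝕥 ⊗ Y) m k) + up
    ≡⟨ cong₂ _+_ (T⊗-coeff Y m k) (𝕩⊗WalksFrom-2+ (suc h) m k) ⟨
  (T ⊗ Y) m k + (𝕩 ⊗ WalksFrom (3 +ℕ h)) m k ∎
  where
  open ≡-Reasoning
  l : ℕ
  l = suc (h +ℕ 2 *ℕ m)
  Y : PS
  Y = WalksFrom (1 +ℕ h)
  up : ℤ
  up = + #walks (3 +ℕ h) l k

record FirstStepSystem (P : ℕ → PS) : Set where
  field
    from-1  : P 1 ≐ (P 0 ⊕ (𝕩 ⊗ P 2))
    from-2+ : ∀ h → P (2 +ℕ h) ≐ ((T ⊗ P (1 +ℕ h)) ⊕ (𝕩 ⊗ P (3 +ℕ h)))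

FirstStepSystem-unique : ∀ {P Q} → FirstStepSystem P → FirstStepSystem Q → P 0 ≐ Q 0 → ∀ h → P h ≐ Q h
FirstStepSystem-unique {P} {Q} P-sys Q-sys P₀≐Q₀ h = ≐[<]⇒≐ (λ r → agree-below (suc r) h)
  where
  module P = FirstStepSystem P-sys
  module Q = FirstStepSystem Q-sys
  agree-below : ∀ r h → P h ≐[ x-grading < r ] Q h
  agree-below zero    h             = agree (λ _ _ ())
  agree-below (suc r) zero          = ≐⇒≐[<] P₀≐Q₀
  agree-below (suc r) 1             =
    ≐[<]-trans (≐⇒≐[<] P.from-1) (≐[<]-trans
      (⊕-agree (agree-below (suc r) 0) (𝕩⊗-contractive (agree-below r 2)))
      (≐⇒≐[<] (PS.sym Q.from-1)))
  agree-below (suc r) (suc (suc h)) =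
    ≐[<]-trans (≐⇒≐[<] (P.from-2+ h)) (≐[<]-trans
      (⊕-agree (⊗-agree (≐[<]-refl T) (agree-below (suc r) (suc h))) (𝕩⊗-contractive (agree-below r (3 +ℕ h))))
      (≐⇒≐[<] (PS.sym (Q.from-2+ h))))

WalksFrom-system : FirstStepSystem WalksFrom
WalksFrom-system = record { from-1 = WalksFrom-1 ; from-2+ = WalksFrom-2+ }

module _ {G : PS} (G-quadratic : G ≐ (𝟙 ⊕ (𝕩 ⊗ (T ⊗ (G ⊗ G))))) where

  open PS-Reasoning
  open PS-Solver

  K : PS
  K = T ⊗ G

  -- A path from height h + 1 first reaches height h through a marked Dyck path
  -- and a down-step, which may be marked unless it lands on the ground.
  FactoredWalks : ℕ → PS
  FactoredWalks 0             = F
  FactoredWalks 1             = G ⊗ F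
  FactoredWalks (suc (suc h)) = K ⊗ FactoredWalks (suc h)

  G⊗-unfold : ∀ Y → (G ⊗ Y) ≐ (Y ⊕ (𝕩 ⊗ (K ⊗ (G ⊗ Y))))
  G⊗-unfold Y = begin
    G ⊗ Y                                  ≈⟨ ⊗-congʳ Y G-quadratic ⟩
    (𝟙 ⊕ (𝕩 ⊗ (T ⊗ (G ⊗ G)))) ⊗ Y        ≈⟨ solve 4 (λ g y x τ → (con 1 :+ x :* (τ :* (g :* g))) :* y
                                                         := y :+ x :* ((τ :* g) :* (g :* y))) PS.refl G Y 𝕩 T ⟩
    Y ⊕ (𝕩 ⊗ (K ⊗ (G ⊗ Y)))                ∎

  K⊗-unfold : ∀ Y → (K ⊗ Y) ≐ ((T ⊗ Y) ⊕ (𝕩 ⊗ (K ⊗ (K ⊗ Y))))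
  K⊗-unfold Y = begin
    (T ⊗ G) ⊗ Y                            ≈⟨ PS.*-assoc T G Y ⟩
    T ⊗ (G ⊗ Y)                            ≈⟨ ⊗-congˡ T (G⊗-unfold Y) ⟩
    T ⊗ (Y ⊕ (𝕩 ⊗ (K ⊗ (G ⊗ Y))))          ≈⟨ solve 5 (λ g y x τ k → τ :* (y :+ x :* (k :* (g :* y)))
                                                         := τ :* y :+ x :* (k :* ((τ :* g) :* y))) PS.refl G Y 𝕩 T K ⟩
    (T ⊗ Y) ⊕ (𝕩 ⊗ (K ⊗ (K ⊗ Y)))          ∎

  FactoredWalks-system : FirstStepSystem FactoredWalks
  FactoredWalks-system = record { from-1 = G⊗-unfold F ; from-2+ = λ h → K⊗-unfold (FactoredWalks (suc h)) }

  F-first-return : F ≐ (𝟙 ⊕ (𝕩 ⊗ (G ⊗ F)))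
  F-first-return = begin
    F                                  ≈⟨ F≐WalksFrom-0 ⟩
    WalksFrom 0                        ≈⟨ WalksFrom-0 ⟩
    𝟙 ⊕ (𝕩 ⊗ WalksFrom 1)              ≈⟨ ⊕-congˡ 𝟙 (⊗-congˡ 𝕩 WalksFrom-1≐G⊗F) ⟩
    𝟙 ⊕ (𝕩 ⊗ (G ⊗ F))                  ∎
    where
    WalksFrom-1≐G⊗F : WalksFrom 1 ≐ (G ⊗ F)
    WalksFrom-1≐G⊗F = FirstStepSystem-unique WalksFrom-system FactoredWalks-system (PS.sym F≐WalksFrom-0) 1

  F⊖𝟙≐𝕩GF : (F ⊖ 𝟙) ≐ (𝕩 ⊗ (G ⊗ F))
  F⊖𝟙≐𝕩GF n k = trans (cong (_- 𝟙 n k) (F-first-return n k)) (i+j-i≡j (𝟙 n k) _)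

  G-split-at-marked-returns : G ≐ (F ⊕ (𝕥 ⊗ ((F ⊖ 𝟙) ⊗ G)))
  G-split-at-marked-returns = begin
    G                              ≈⟨ fixedPoint-unique (affine-contractive 𝕩 𝕩⊗-contractive a G) G-fixed Z-fixed ⟩
    Z                              ≈⟨ ⊕-congˡ F (⊗-congˡ 𝕥 (⊗-congʳ G (PS.sym F⊖𝟙≐𝕩GF))) ⟩
    F ⊕ (𝕥 ⊗ ((F ⊖ 𝟙) ⊗ G))        ∎
    where
    a Z F′ : PS
    a  = 𝟙 ⊕ (𝕥 ⊗ (𝕩 ⊗ (G ⊗ G)))
    Z  = F ⊕ (𝕥 ⊗ ((𝕩 ⊗ (G ⊗ F)) ⊗ G))
    F′ = 𝟙 ⊕ (𝕩 ⊗ (G ⊗ F))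

    G-fixed : G ≐ (a ⊕ (𝕩 ⊗ (G ⊗ G)))
    G-fixed = begin
      G                          ≈⟨ G-quadratic ⟩
      𝟙 ⊕ (𝕩 ⊗ (T ⊗ (G ⊗ G)))
        ≈⟨ solve 3 (λ g x t → con 1 :+ x :* ((con 1 :+ t) :* (g :* g))
                              := (con 1 :+ t :* (x :* (g :* g))) :+ x :* (g :* g)) PS.refl G 𝕩 𝕥 ⟩
      a ⊕ (𝕩 ⊗ (G ⊗ G))          ∎

    Z-fixed : Z ≐ (a ⊕ (𝕩 ⊗ (G ⊗ Z)))
    Z-fixed = begin
      Z
        ≈⟨ PS.+-cong F-first-return (⊗-congˡ 𝕥 (⊗-congʳ G (⊗-congˡ 𝕩 (⊗-congˡ G F-first-return)))) ⟩
      F′ ⊕ (𝕥 ⊗ ((𝕩 ⊗ (G ⊗ F′)) ⊗ G))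
        ≈⟨ solve 4 (λ g f x t → (con 1 :+ x :* (g :* f)) :+ t :* ((x :* (g :* (con 1 :+ x :* (g :* f)))) :* g)
                                := (con 1 :+ t :* (x :* (g :* g))) :+ x :* (g :* (f :+ t :* ((x :* (g :* f)) :* g))))
                   PS.refl G F 𝕩 𝕥 ⟩
      a ⊕ (𝕩 ⊗ (G ⊗ Z))          ∎

  G≐F⊗inv1-t : G ≐ (F ⊗ inv1-t (F ⊖ 𝟙))
  G≐F⊗inv1-t = fixedPoint-unique (affine-contractive 𝕥 𝕥⊗-contractive F A) G-split-at-marked-returns (begin
    F ⊗ inv1-t A                      ≈⟨ ⊗-congˡ F (inv1-t-rec A) ⟩
    F ⊗ (𝟙 ⊕ (𝕥 ⊗ (A ⊗ inv1-t A)))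
      ≈⟨ solve 4 (λ f i a t → f :* (con 1 :+ t :* (a :* i)) := f :+ t :* (a :* (f :* i))) PS.refl F (inv1-t A) A 𝕥 ⟩
    F ⊕ (𝕥 ⊗ (A ⊗ (F ⊗ inv1-t A)))    ∎)
    where
    A : PS
    A = F ⊖ 𝟙

  F-functional-equation : F ≐ (𝟙 ⊕ ((𝕩 ⊗ (F ⊗ F)) ⊗ inv1-t (F ⊖ 𝟙)))
  F-functional-equation = begin
    F                          ≈⟨ F-first-return ⟩
    𝟙 ⊕ (𝕩 ⊗ (G ⊗ F))          ≈⟨ ⊕-congˡ 𝟙 (⊗-congˡ 𝕩 (⊗-congʳ F G≐F⊗inv1-t)) ⟩
    𝟙 ⊕ (𝕩 ⊗ ((F ⊗ I) ⊗ F))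
      ≈⟨ solve 3 (λ f i x → con 1 :+ x :* ((f :* i) :* f) := con 1 :+ (x :* (f :* f)) :* i) PS.refl F I 𝕩 ⟩
    𝟙 ⊕ ((𝕩 ⊗ (F ⊗ F)) ⊗ I)    ∎
    where
    I : PS
    I = inv1-t (F ⊖ 𝟙)

MarkedDyck-map-contractive : Contractive x-grading (λ Y → 𝟙 ⊕ (𝕩 ⊗ (T ⊗ (Y ⊗ Y))))
MarkedDyck-map-contractive Y≐Y′ =
  ⊕-agree (≐[<]-refl 𝟙) (𝕩⊗-contractive (⊗-agree (≐[<]-refl T) (⊗-agree Y≐Y′ Y≐Y′)))

MarkedDyck : PS
MarkedDyck = fixedPoint MarkedDyck-map-contractive

theorem7 : F ≐ (𝟙 ⊕ ((𝕩 ⊗ (F ⊗ F)) ⊗ inv1-t (F ⊖ 𝟙)))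
theorem7 = F-functional-equation {G = MarkedDyck} (fixedPoint-eq MarkedDyck-map-contractive)
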